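{- Let $f$ be a function from the family of hypergraphs to $\mathbb{Z}_{\geq 0}\cup\{\infty\}$ and let $\mathcal{C}$ be a hypergraph. If $f$ is inductive on $\mathcal{C}$, then $\psi(\mathcal{C})\geq f(\mathcal{C})$.
   Context: A hypergraph $\mathcal{C}$ on a finite vertex set $V$ is a family of pairwise incomparable subsets of $V$ (edges), each of cardinality at least $2$; isolated vertices allowed. For an edge $F$: $\mathcal{C}-F$ has vertex set $V$ and edge set $\mathcal{C}\setminus\{F\}$; $N_{\mathcal{C}}(F)=\bigcup\{E\setminus F: E\in\mathcal{C},|E\setminus F|=1\}$; $\mathcal{C}:F$ is the hypergraph on $V\setminus(F\cup N_{\mathcal{C}}(F))$ whose edges are the inclusion-minimal sets among $\{E\setminus F:E\in\mathcal{C}-F\}$ of size at least $2$ (those meeting $N_{\mathcal{C}}(F)$ discarded). $\psi(\mathcal{C})\in\mathbb{Z}_{\ge0}\cup\{\infty\}$: $\psi=0$ if $V=\emptyset$; $\psi=\infty$ if $V\ne\emptyset$ and $\mathcal{C}=\emptyset$; otherwise $\psi(\mathcal{C})=\max_{F\in\mathcal{C}}\min\{\psi(\mathcal{C}-F),\psi(\mathcal{C}:F)+|F|-1\}$. A function $f$ is inductive on $\mathcal{C}$ if: (i) $f(\mathcal{C})=\infty$ when $\mathcal{C}=\emptyset$ and $V\neq\emptyset$; (ii) $f(\mathcal{C})=0$ when $V=\emptyset$; (iii) if $\mathcal{C}\ne\emptyset$, there is an edge $K$ of $\mathcal{C}$ with $f(\mathcal{C})\le f(\mathcal{C}-K)$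 and $f(\mathcal{C})\le f(\mathcal{C}:K)+|K|-1$ such that $f$ is inductive on $\mathcal{C}-K$ and on $\mathcal{C}:K$ (a recursive definition on the number of edges). -}

module Defs where

open import Data.Nat using (ℕ; zero; suc; _∸_; _≡ᵇ_; _≤ᵇ_) renaming (_≤_ to _≤ℕ_; _+_ to _+ℕ_; _⊔_ to _⊔ℕ_; _⊓_ to _⊓ℕ_)
open import Data.Bool using (Bool; true; false; not; _∧_; _∨_; if_then_else_)
import Data.Bool.Properties as BoolP
open import Data.List using (List; []; _∷_; filter; map; foldr; length)
open import Data.List.Membership.Propositional using (_∈_)
open import Data.List.Relation.Unary.All using (All)
open import Data.List.Relation.Unary.AllPairs using (AllPairs)
open import Data.Fin.Subset using (Subset; _⊆_; _∪_; _∩_; _─_; ∣_∣; ⊥; Nonempty; Empty)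
open import Data.Fin.Subset.Properties using (_⊆?_; nonempty?)
open import Data.Vec.Properties using (≡-dec)
open import Data.Product using (_×_)
open import Relation.Nullary using (¬_; Dec; yes; no; ⌊_⌋)
open import Relation.Binary.PropositionalEquality using (_≡_)

data ℕ∞ : Set where
  fin : ℕ → ℕ∞
  ∞   : ℕ∞

infix 4 _≤∞_
data _≤∞_ : ℕ∞ → ℕ∞ → Set where
  fin≤fin : ∀ {m n} → m ≤ℕ n → fin m ≤∞ fin n
  _≤∞∞    : ∀ x → x ≤∞ ∞

_+∞_ : ℕ∞ → ℕ → ℕ∞
fin m +∞ k = fin (m +ℕ k)
∞     +∞ k = ∞

min∞ : ℕ∞ → ℕ∞ → ℕ∞
min∞ (fin m) (fin n) = fin (m ⊓ℕ n)
min∞ (fin m) ∞       = fin m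
min∞ ∞       y       = y

max∞ : ℕ∞ → ℕ∞ → ℕ∞
max∞ (fin m) (fin n) = fin (m ⊔ℕ n)
max∞ (fin m) ∞       = ∞
max∞ ∞       y       = ∞

-- Hypergraphs with vertices in the ambient finite set Fin n.
-- Raw data: a vertex set V and a list of edges (each a subset of Fin n).

IsHypergraph : ∀ {n} → Subset n → List (Subset n) → Set
IsHypergraph V E =
  All (λ A → A ⊆ V × 2 ≤ℕ ∣ A ∣) E ×
  AllPairs (λ A B → ¬ A ⊆ B × ¬ B ⊆ A) E

module _ {n : ℕ} where

  _==_ : Subset n → Subset n → Bool
  A == B = ⌊ ≡-dec BoolP._≟_ A B ⌋

  _⊆ᵇ_ : Subset n → Subset n → Bool
  A ⊆ᵇ B = ⌊ A ⊆? B ⌋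

  isEmptyᵇ : Subset n → Bool
  isEmptyᵇ A = not ⌊ nonempty? A ⌋

  delEdge : Subset n → List (Subset n) → List (Subset n)
  delEdge F E = filter (λ A → Dec-not (≡-dec BoolP._≟_ A F)) E
    where
    Dec-not : ∀ {P : Set} → Dec P → Dec (¬ P)
    Dec-not (yes p) = no (λ np → np p)
    Dec-not (no np) = yes np

  nbhd : Subset n → List (Subset n) → Subset n
  nbhd F E = foldr (λ A acc → if ∣ A ─ F ∣ ≡ᵇ 1 then (A ─ F) ∪ acc else acc) ⊥ E

  filterᵇ : (Subset n → Bool) → List (Subset n) → List (Subset n)
  filterᵇ p []       = []
  filterᵇ p (x ∷ xs) = if p x then x ∷ filterᵇ p xs else filterᵇ p xs

  dedup : List (Subset n) → List (Subset n)
  dedup []       = []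
  dedup (A ∷ As) = A ∷ filterᵇ (λ B → not (A == B)) (dedup As)

  anyᵇ : (Subset n → Bool) → List (Subset n) → Bool
  anyᵇ p []       = false
  anyᵇ p (x ∷ xs) = p x ∨ anyᵇ p xs

  minimals : List (Subset n) → List (Subset n)
  minimals Xs = filterᵇ (λ X → not (anyᵇ (λ Y → (Y ⊆ᵇ X) ∧ not (Y == X)) Xs)) Xs

  colonV : Subset n → List (Subset n) → Subset n → Subset n
  colonV V E F = V ─ (F ∪ nbhd F E)

  colonE : List (Subset n) → Subset n → List (Subset n)
  colonE E F =
    dedup (minimals
      (filterᵇ (λ A → (2 ≤ᵇ ∣ A ∣) ∧ isEmptyᵇ (A ∩ nbhd F E))
               (map (λ A → A ─ F) (delEdge F E))))

  -- ψ, computed with fuel; fuel = number of edges always suffices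
  -- since C - F and C : F have strictly fewer edges than C.
  baseψ : Subset n → ℕ∞
  baseψ V = if isEmptyᵇ V then fin 0 else ∞

  ψ-fuel : ℕ → Subset n → List (Subset n) → ℕ∞
  ψ-fuel zero    V E        = baseψ V
  ψ-fuel (suc k) V []       = baseψ V
  ψ-fuel (suc k) V (A ∷ As) = foldr (λ F acc → max∞ (val F) acc) (fin 0) (A ∷ As)
    where
    val : Subset n → ℕ∞
    val F = min∞ (ψ-fuel k V (delEdge F (A ∷ As)))
                 (ψ-fuel k (colonV V (A ∷ As) F) (colonE (A ∷ As) F) +∞ (∣ F ∣ ∸ 1))

  ψ : Subset n → List (Subset n) → ℕ∞
  ψ V E = ψ-fuel (length E) V E

  data Inductive (f : Subset n → List (Subset n) → ℕ∞) :
                 Subset n → List (Subset n) → Set where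
    base : ∀ {V} →
           (Nonempty V → f V [] ≡ ∞) →
           (Empty V → f V [] ≡ fin 0) →
           Inductive f V []
    step : ∀ {V E} (K : Subset n) → K ∈ E →
           (Empty V → f V E ≡ fin 0) →
           f V E ≤∞ f V (delEdge K E) →
           f V E ≤∞ (f (colonV V E K) (colonE E K) +∞ (∣ K ∣ ∸ 1)) →
           Inductive f V (delEdge K E) →
           Inductive f (colonV V E K) (colonE E K) →
           Inductive f V E

-- Induction on the derivation that f is inductive on C. The witness edge K
-- gives f(C) ≤ f(C - K) ≤ ψ(C - K) and f(C) ≤ f(C : K) + |K| - 1 ≤ ψ(C : K) + |K| - 1
-- by the induction hypotheses, so f(C) is below the K-term of the maximum defining
-- ψ(C). Since C - K and C : K have fewer edges than C, the fuel length E with which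
-- ψ is computed suffices at every level of the recursion.
module Submission where

open import Defs
open import Data.Nat using (ℕ; zero; suc; _≤_; _<_; z≤n; s≤s; _∸_; _≤ᵇ_)
open import Data.Nat.Properties
  using (≤-trans; ≤-refl; ≤-reflexive; m≤n⇒m≤1+n; ≤-pred; ⊓-glb; m≤n⇒m≤n⊔o; m≤n⇒m≤o⊔n; +-monoˡ-≤)
open import Data.Bool using (Bool; true; false; _∧_)
open import Data.List using (List; []; _∷_; length; map; foldr)
open import Data.List.Properties using (length-map; filter-notAll)
open import Data.List.Membership.Propositional using (_∈_)
open import Data.List.Relation.Unary.Any using (here; there)
import Data.List.Relation.Unary.Any as Any
open import Data.Fin.Subset using (Subset; ∣_∣; _─_; _∩_; Empty)
open import Data.Fin.Subset.Properties using (nonempty?)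
open import Relation.Nullary using (yes; no)
open import Relation.Binary.PropositionalEquality using (_≡_; refl)

≤∞-trans : ∀ {a b c} → a ≤∞ b → b ≤∞ c → a ≤∞ c
≤∞-trans (fin≤fin p) (fin≤fin q) = fin≤fin (≤-trans p q)
≤∞-trans {a} _       (_ ≤∞∞)     = a ≤∞∞

≤∞-min∞ : ∀ {x a b} → x ≤∞ a → x ≤∞ b → x ≤∞ min∞ a b
≤∞-min∞ (fin≤fin p) (fin≤fin q) = fin≤fin (⊓-glb p q)
≤∞-min∞ (fin≤fin p) (_ ≤∞∞)     = fin≤fin p
≤∞-min∞ (_ ≤∞∞)     q           = q

≤∞-max∞ˡ : ∀ {x a} b → x ≤∞ a → x ≤∞ max∞ a b
≤∞-max∞ˡ (fin m) (fin≤fin p) = fin≤fin (m≤n⇒m≤n⊔o m p)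
≤∞-max∞ˡ ∞       (fin≤fin p) = _ ≤∞∞
≤∞-max∞ˡ b       (x ≤∞∞)     = x ≤∞∞

≤∞-max∞ʳ : ∀ {x b} a → x ≤∞ b → x ≤∞ max∞ a b
≤∞-max∞ʳ (fin m) (fin≤fin p) = fin≤fin (m≤n⇒m≤o⊔n m p)
≤∞-max∞ʳ (fin m) (x ≤∞∞)     = x ≤∞∞
≤∞-max∞ʳ ∞       _           = _ ≤∞∞

+∞-monoˡ-≤∞ : ∀ {a b} k → a ≤∞ b → a +∞ k ≤∞ b +∞ k
+∞-monoˡ-≤∞ k (fin≤fin p) = fin≤fin (+-monoˡ-≤ k p)
+∞-monoˡ-≤∞ {a} k (_ ≤∞∞) = (a +∞ k) ≤∞∞

≤∞-foldr-max∞ : ∀ {A : Set} {x} (g : A → ℕ∞) {xs : List A} {y} → y ∈ xs → x ≤∞ g y →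
                x ≤∞ foldr (λ z acc → max∞ (g z) acc) (fin 0) xs
≤∞-foldr-max∞ g (here refl) p = ≤∞-max∞ˡ _ p
≤∞-foldr-max∞ g {z ∷ _} (there y∈xs) p = ≤∞-max∞ʳ (g z) (≤∞-foldr-max∞ g y∈xs p)

module _ {n : ℕ} where

  length-filterᵇ : ∀ (p : Subset n → Bool) xs → length (filterᵇ p xs) ≤ length xs
  length-filterᵇ p []       = z≤n
  length-filterᵇ p (x ∷ xs) with p x
  ... | true  = s≤s (length-filterᵇ p xs)
  ... | false = m≤n⇒m≤1+n (length-filterᵇ p xs)

  length-dedup : ∀ xs → length (dedup {n} xs) ≤ length xs
  length-dedup []       = z≤n
  length-dedup (x ∷ xs) = s≤s (≤-trans (length-filterᵇ _ (dedup xs)) (length-dedup xs))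

  length-minimals : ∀ xs → length (minimals {n} xs) ≤ length xs
  length-minimals xs = length-filterᵇ _ xs

  length-delEdge-< : ∀ {K} {E : List (Subset n)} → K ∈ E → length (delEdge K E) < length E
  length-delEdge-< {E = E} K∈E = filter-notAll _ E (Any.map (λ { refl K≢K → K≢K refl }) K∈E)

  length-colonE : ∀ (E : List (Subset n)) K → length (colonE E K) ≤ length (delEdge K E)
  length-colonE E K =
    ≤-trans (length-dedup (minimals survivors))
    (≤-trans (length-minimals survivors)
    (≤-trans (length-filterᵇ keep (map (_─ K) (delEdge K E)))
             (≤-reflexive (length-map (_─ K) (delEdge K E)))))
    where
    keep : Subset n → Bool
    keep A = (2 ≤ᵇ ∣ A ∣) ∧ isEmptyᵇ (A ∩ nbhd K E)
    survivors : List (Subset n)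
    survivors = filterᵇ keep (map (_─ K) (delEdge K E))

  ψ-fuel-[] : ∀ k (V : Subset n) → ψ-fuel k V [] ≡ baseψ V
  ψ-fuel-[] zero    V = refl
  ψ-fuel-[] (suc k) V = refl

  ≤∞-baseψ : ∀ {f : Subset n → List (Subset n) → ℕ∞} {V} →
             (Empty V → f V [] ≡ fin 0) → f V [] ≤∞ baseψ V
  ≤∞-baseψ {f} {V} empty⇒0 with nonempty? V
  ... | yes _ = f V [] ≤∞∞
  ... | no ¬nonempty rewrite empty⇒0 ¬nonempty = fin≤fin z≤n

  inductive⇒≤ψ-fuel : ∀ {f V E} k → length E ≤ k → Inductive f V E → f V E ≤∞ ψ-fuel k V E
  inductive⇒≤ψ-fuel {f} {V} k _ (base _ empty⇒0) rewrite ψ-fuel-[] k V = ≤∞-baseψ {f = f} empty⇒0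
  inductive⇒≤ψ-fuel {f} {V} {E@(_ ∷ _)} (suc k) E≤1+k (step K K∈E _ f≤f-K f≤f:K ind-K ind:K) =
    ≤∞-foldr-max∞ term K∈E
      (≤∞-min∞ (≤∞-trans f≤f-K ψ-K) (≤∞-trans f≤f:K (+∞-monoˡ-≤∞ (∣ K ∣ ∸ 1) ψ:K)))
    where
    term : Subset n → ℕ∞
    term F = min∞ (ψ-fuel k V (delEdge F E))
                  (ψ-fuel k (colonV V E F) (colonE E F) +∞ (∣ F ∣ ∸ 1))
    E-K≤k : length (delEdge K E) ≤ k
    E-K≤k = ≤-pred (≤-trans (length-delEdge-< K∈E) E≤1+k)
    ψ-K = inductive⇒≤ψ-fuel k E-K≤k ind-K
    ψ:K = inductive⇒≤ψ-fuel k (≤-trans (length-colonE E K) E-K≤k) ind:K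

lemma3p10 : (n : ℕ) (f : Subset n → List (Subset n) → ℕ∞)
            (V : Subset n) (E : List (Subset n)) →
            IsHypergraph V E →
            Inductive f V E →
            f V E ≤∞ ψ V E
lemma3p10 n f V E _ ind = inductive⇒≤ψ-fuel (length E) ≤-refl ind
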